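{- Let $p,q$ be nonnegative integers, $m=p+q$, and let $\boldsymbol{x}=(x_1,\dots,x_m)$, $\boldsymbol{a}=(a_1,\dots,a_m)$ be vectors of indeterminates. Then, as an identity of Laurent polynomials, $$ F^{p,q}(\boldsymbol{x};\boldsymbol{a}) = (-1)^{\binom{p}{2}+\binom{q}{2}} \prod_{i=1}^{m} x_i^{p-1} \cdot \det V^{p,q}(\boldsymbol{x}+\boldsymbol{x}^{ -1};\boldsymbol{a} \boldsymbol{x}^{q-p}) = (-1)^{\binom{p}{2}+\binom{q}{2}}\det W, $$ where $\boldsymbol{x}+\boldsymbol{x}^{ -1}=(x_1+x_1^{ -1},\dots,x_m+x_m^{ -1})$, $\boldsymbol{a}\boldsymbol{x}^{q-p}=(a_1x_1^{q-p},\dots,a_mx_m^{q-p})$, and $W$ is the $m\times m$ matrix whose $i$th row is $$\big(x_i^{p-1-k}(1+x_i^2)^{k}\big)_{k=0,\dots,p-1}\ \text{followed by}\ \big(a_i\,x_i^{q-1-k}(1+x_i^2)^{k}\big)_{k=0,\dots,q-1}.$$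
   Context: Partitions are written also in Frobenius notation $(\alpha_1,\dots,\alpha_r\,|\,\beta_1,\dots,\beta_r)$, where $r$ is the number of diagonal boxes, $\alpha_i=\lambda_i-i$, $\beta_i=\lambda'_i-i$; $|\lambda|$ is the size. For an integer $m\ge 0$, $\mathcal{P}_m$ is the set of partitions of the form $(\alpha_1,\dots,\alpha_r\,|\,\alpha_1+1,\dots,\alpha_r+1)$ with $r\ge0$ and length at most $m$ (the empty partition included). For $p+q=N$, vectors $\boldsymbol{x},\boldsymbol{a}$ of length $N$ and partitions $\lambda,\mu$ with $\ell(\lambda)\le p$, $\ell(\mu)\le q$, $V^{p,q}_{\lambda,\mu}(\boldsymbol{x};\boldsymbol{a})$ is the $N\times N$ matrix with $i$th row $(x_i^{\lambda_p}, x_i^{\lambda_{p-1}+1},\dots,x_i^{\lambda_1+p-1}, a_ix_i^{\mu_q},\dots,a_ix_i^{\mu_1+q-1})$, and $V^{p,q}(\boldsymbol{x};\boldsymbol{a})=V^{p,q}_{\emptyset,\emptyset}(\boldsymbol{x};\boldsymbol{a})$, i.e. the matrix with $i$th row $(1,x_i,\dots,x_i^{p-1},a_i,a_ix_i,\dots,a_ix_i^{q-1})$. Define $F^{p,q}(\boldsymbol{x};\boldsymbol{a})=\sum_{\lambda\in\mathcal{P}_p,\mu\in\mathcal{P}_q}(-1)^{(|\lambda|+|\mu|)/2}\det V^{p,q}_{\lambda,\mu}(\boldsymbol{x};\boldsymbol{a})$. -}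

module Defs where

open import Level using (Level)
open import Data.Nat as ℕ using (ℕ; zero; suc; _∸_; _≤ᵇ_; ⌊_/2⌋)
open import Data.Integer as ℤ using (ℤ; +_; -[1+_])
open import Data.Fin using (Fin; zero; suc; toℕ; punchIn; splitAt)
open import Data.Sum using (inj₁; inj₂)
open import Data.List using (List; []; _∷_; _++_; map; length; foldr)
open import Data.Bool using (if_then_else_)
open import Algebra.Bundles using (CommutativeRing)

strictDecs : ℕ → List (List ℕ)
strictDecs zero    = [] ∷ []
strictDecs (suc n) = strictDecs n ++ map (n ∷_) (strictDecs n)

nth : List ℕ → ℕ → ℕ
nth []       _       = 0
nth (a ∷ as) zero    = a
nth (a ∷ as) (suc k) = nth as k

countUpTo : ℕ → (ℕ → ℕ) → ℕ → ℕ
countUpTo zero    f i = 0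
countUpTo (suc r) f i =
  countUpTo r f i ℕ.+ (if i ≤ᵇ f (suc r) then 1 else 0)

-- i-th part (i ≥ 1) of the partition with Frobenius coordinates
-- (α₁,…,α_r | β₁,…,β_r), β_j = α_j + 1, given the list αs = α₁,…,α_r:
--   λ_i = α_i + i                         if i ≤ r
--   λ_i = #{ j ≤ r : β_j + j ≥ i }        if i > r
frobPart : List ℕ → ℕ → ℕ
frobPart αs i =
  if i ≤ᵇ length αs
  then nth αs (i ∸ 1) ℕ.+ i
  else countUpTo (length αs) (λ j → nth αs (j ∸ 1) ℕ.+ 1 ℕ.+ j) i

-- Frobenius data (as lists α₁ > … > α_r ≥ 0) of the members of 𝒫_m.
-- A partition (α|α+1) with r ≥ 1 has length β₁ + 1 = α₁ + 2, so the
-- condition ℓ(λ) ≤ m is α₁ + 2 ≤ m, i.e. all αᵢ < m ∸ 1.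
𝒫 : ℕ → List (List ℕ)
𝒫 m = strictDecs (m ∸ 1)

sizeUpTo : ℕ → List ℕ → ℕ
sizeUpTo zero    αs = 0
sizeUpTo (suc n) αs = sizeUpTo n αs ℕ.+ frobPart αs (suc n)

module WithRing {c ℓ : Level} (R : CommutativeRing c ℓ) where
  open CommutativeRing R using (Carrier; _+_; _*_; -_; 0#; 1#)

  pow : Carrier → ℕ → Carrier
  pow y zero    = 1#
  pow y (suc n) = y * pow y n

  zpow : Carrier → Carrier → ℤ → Carrier
  zpow y yinv (+ n)    = pow y n
  zpow y yinv -[1+ n ] = pow yinv (suc n)

  sumFin : ∀ n → (Fin n → Carrier) → Carrier
  sumFin zero    f = 0#
  sumFin (suc n) f = f zero + sumFin n (λ j → f (suc j))

  prodFin : ∀ n → (Fin n → Carrier) → Carrier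
  prodFin zero    f = 1#
  prodFin (suc n) f = f zero * prodFin n (λ j → f (suc j))

  sumList : {A : Set} → List A → (A → Carrier) → Carrier
  sumList xs f = foldr (λ a s → f a + s) 0# xs

  det : ∀ n → (Fin n → Fin n → Carrier) → Carrier
  det zero    M = 1#
  det (suc n) M =
    sumFin (suc n) (λ j →
      pow (- 1#) (toℕ j) * (M zero j * det n (λ r k → M (suc r) (punchIn j k))))

  Vλμ : ∀ p q → List ℕ → List ℕ → (Fin (p ℕ.+ q) → Carrier) →
        (Fin (p ℕ.+ q) → Carrier) → Fin (p ℕ.+ q) → Fin (p ℕ.+ q) → Carrier
  Vλμ p q λs μs x a i col with splitAt p col
  ... | inj₁ k = pow (x i) (frobPart λs (p ∸ toℕ k) ℕ.+ toℕ k)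
  ... | inj₂ l = a i * pow (x i) (frobPart μs (q ∸ toℕ l) ℕ.+ toℕ l)

  V : ∀ p q → (Fin (p ℕ.+ q) → Carrier) → (Fin (p ℕ.+ q) → Carrier) →
      Fin (p ℕ.+ q) → Fin (p ℕ.+ q) → Carrier
  V p q = Vλμ p q [] []

  F : ∀ p q → (Fin (p ℕ.+ q) → Carrier) → (Fin (p ℕ.+ q) → Carrier) → Carrier
  F p q x a =
    sumList (𝒫 p) (λ λs → sumList (𝒫 q) (λ μs →
      pow (- 1#) ⌊ (sizeUpTo p λs ℕ.+ sizeUpTo q μs) /2⌋
        * det (p ℕ.+ q) (Vλμ p q λs μs x a)))

  W : ∀ p q → (Fin (p ℕ.+ q) → Carrier) → (Fin (p ℕ.+ q) → Carrier) →
      Fin (p ℕ.+ q) → Fin (p ℕ.+ q) → Carrier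
  W p q x a i col with splitAt p col
  ... | inj₁ k = pow (x i) (p ∸ 1 ∸ toℕ k) * pow (1# + x i * x i) (toℕ k)
  ... | inj₂ l = a i * (pow (x i) (q ∸ 1 ∸ toℕ l) * pow (1# + x i * x i) (toℕ l))

-- All determinants involved are multilinear and alternating in each of their two column blocks, so the
-- work is done for an arbitrary alternating multilinear function D of p columns.  For such D the
-- signed sum over λ ∈ 𝒫_p of D(x^{λ_p}, x^{λ_{p-1}+1}, …, x^{λ_1+p-1}) equals ±D of the columns
-- x^{p-1}(x^k + x^{-k}) (and x^{p-1} for k = 0).  This goes by induction on p: the last column is
-- x^{p-1}(x^{1-p} + x^{p-1}) = 1 + x^{2p-2}, and expanding it splits D into two terms; the first,
-- after moving the column of ones to the front, matches the λ with λ_p = 0, and the second matches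
-- the λ with α₁ = p - 2, which arise from partitions in 𝒫_{p-1} by adding a hook.  Next,
-- (x + x^{-1})^k is x^k + x^{-k} plus a combination of the x^j + x^{-j} with j < k, so triangular
-- column operations replace x^{p-1}(x^k + x^{-k}) by x^{p-1}(x + x^{-1})^k = x^{p-1-k}(1 + x^2)^k,
-- the columns of W.  Finally row i of W is x_i^{p-1} times row i of V(x + x^{-1}; a x^{q-p}).

module Submission where

open import Defs
open import Level using (Level; _⊔_)
open import Data.Nat as ℕ using (ℕ; zero; suc; z≤n; s≤s; _∸_; ⌊_/2⌋)
open import Data.Nat.Combinatorics using (_C_)
import Data.Nat.Combinatorics as ℕC
import Data.Nat.Properties as ℕP
open import Data.Nat.Solver using (module +-*-Solver)
open import Data.Fin as Fin using (Fin; zero; suc; toℕ; punchIn; splitAt)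
import Data.Fin.Properties as FinP
open import Data.Product using (_×_; _,_; Σ-syntax; proj₁; proj₂)
open import Data.Sum using (_⊎_; inj₁; inj₂; [_,_]′)
open import Data.Sum.Properties using ([,]-map)
open import Data.Empty using (⊥-elim)
open import Algebra.Bundles using (CommutativeRing)
import Algebra.Properties.Ring as RingProperties
import Algebra.Properties.Group as GroupProperties
import Algebra.Properties.CommutativeSemiring.Exp as Exp
import Algebra.Solver.Ring.NaturalCoefficients.Default as NaturalSolver
open import Data.Integer as ℤ using (+_)
import Data.Integer.Properties as ℤP
open import Data.List using (List; []; _∷_; _++_; map; length)
open import Data.List.Relation.Unary.All as All using (All; []; _∷_)
import Data.List.Relation.Unary.All.Properties as All
open import Data.Bool using (if_then_else_)
open import Function using (_∘_)
open import Relation.Nullary using (yes; no; ¬_)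
open import Relation.Nullary.Decidable using (dec-true; dec-false)
open import Relation.Binary.PropositionalEquality as P using (_≡_; _≢_)

-- Frobenius data

data StrictDec : ℕ → List ℕ → Set where
  []  : ∀ {n} → StrictDec n []
  _∷_ : ∀ {n a L} → a ℕ.< n → StrictDec a L → StrictDec n (a ∷ L)

StrictDec-weaken : ∀ {n m L} → n ℕ.≤ m → StrictDec n L → StrictDec m L
StrictDec-weaken n≤m []         = []
StrictDec-weaken n≤m (a<n ∷ sL) = ℕP.<-≤-trans a<n n≤m ∷ sL

strictDecs-StrictDec : ∀ n → All (StrictDec n) (strictDecs n)
strictDecs-StrictDec zero    = [] ∷ []
strictDecs-StrictDec (suc n) =
  All.++⁺ (All.map (StrictDec-weaken (ℕP.n≤1+n n)) (strictDecs-StrictDec n))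
          (All.map⁺ (All.map (ℕP.n<1+n n ∷_) (strictDecs-StrictDec n)))

StrictDec⇒length≤ : ∀ {n L} → StrictDec n L → length L ℕ.≤ n
StrictDec⇒length≤ []         = z≤n
StrictDec⇒length≤ (a<n ∷ sL) = ℕP.≤-trans (s≤s (StrictDec⇒length≤ sL)) a<n

StrictDec⇒nth+j< : ∀ {n L} → StrictDec n L → ∀ {j} → j ℕ.< length L → nth L j ℕ.+ j ℕ.< n
StrictDec⇒nth+j< {n} (a<n ∷ sL) {zero}  _         = P.subst (ℕ._< n) (P.sym (ℕP.+-identityʳ _)) a<n
StrictDec⇒nth+j< {n} (a<n ∷ sL) {suc j} (s≤s j<l) =
  P.subst (ℕ._< n) (P.sym (ℕP.+-suc _ j)) (ℕP.<-≤-trans (s≤s (StrictDec⇒nth+j< sL j<l)) a<n)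

countUpTo-none : ∀ r f i → (∀ j → 1 ℕ.≤ j → j ℕ.≤ r → f j ℕ.< i) → countUpTo r f i ≡ 0
countUpTo-none zero    f i below = P.refl
countUpTo-none (suc r) f i below
  rewrite countUpTo-none r f i (λ j 1≤j j≤r → below j 1≤j (ℕP.m≤n⇒m≤1+n j≤r))
        | dec-false (i ℕ.≤? f (suc r)) (ℕP.<⇒≱ (below (suc r) (s≤s z≤n) ℕP.≤-refl)) = P.refl

countUpTo-cong : ∀ r {f g} i → (∀ j → 1 ℕ.≤ j → j ℕ.≤ r → f j ≡ g j) → countUpTo r f i ≡ countUpTo r g i
countUpTo-cong zero    i f≗g = P.refl
countUpTo-cong (suc r) i f≗g =
  P.cong₂ (λ c v → c ℕ.+ (if i ℕ.≤ᵇ v then 1 else 0))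
    (countUpTo-cong r i (λ j 1≤j j≤r → f≗g j 1≤j (ℕP.m≤n⇒m≤1+n j≤r))) (f≗g (suc r) (s≤s z≤n) ℕP.≤-refl)

≤ᵇ-suc : ∀ i v → (suc i ℕ.≤ᵇ suc v) ≡ (i ℕ.≤ᵇ v)
≤ᵇ-suc zero    v = P.refl
≤ᵇ-suc (suc i) v = P.refl

countUpTo-suc : ∀ r f i → countUpTo r (λ j → suc (f j)) (suc i) ≡ countUpTo r f i
countUpTo-suc zero    f i = P.refl
countUpTo-suc (suc r) f i =
  P.cong₂ (λ c b → c ℕ.+ (if b then 1 else 0)) (countUpTo-suc r f i) (≤ᵇ-suc i (f (suc r)))

countUpTo-first : ∀ r f i → i ℕ.≤ f 1 → countUpTo (suc r) f i ≡ suc (countUpTo r (λ j → f (suc j)) i)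
countUpTo-first zero    f i i≤f1 rewrite dec-true (i ℕ.≤? f 1) i≤f1 = P.refl
countUpTo-first (suc r) f i i≤f1 =
  P.cong (ℕ._+ (if i ℕ.≤ᵇ f (suc (suc r)) then 1 else 0)) (countUpTo-first r f i i≤f1)

frobPart-[] : ∀ i → frobPart [] i ≡ 0
frobPart-[] zero    = P.refl
frobPart-[] (suc i) = P.refl

frobPart-inside : ∀ L {i} → i ℕ.≤ length L → frobPart L i ≡ nth L (i ∸ 1) ℕ.+ i
frobPart-inside L {i} i≤l rewrite dec-true (i ℕ.≤? length L) i≤l = P.refl

frobPart-outside : ∀ L {i} → length L ℕ.< i →
  frobPart L i ≡ countUpTo (length L) (λ j → nth L (j ∸ 1) ℕ.+ 1 ℕ.+ j) i
frobPart-outside L {i} l<i rewrite dec-false (i ℕ.≤? length L) (ℕP.<⇒≱ l<i) = P.refl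

frobPart-beyond : ∀ {n L} → StrictDec n L → ∀ {i} → suc n ℕ.< i → frobPart L i ≡ 0
frobPart-beyond {n} {L} sL {i} 1+n<i =
  P.trans (frobPart-outside L (ℕP.≤-<-trans (StrictDec⇒length≤ sL) (ℕP.<-trans (ℕP.n<1+n n) 1+n<i)))
          (countUpTo-none (length L) _ i below)
  where
  below : ∀ j → 1 ℕ.≤ j → j ℕ.≤ length L → nth L (j ∸ 1) ℕ.+ 1 ℕ.+ j ℕ.< i
  below (suc j) _ j<l =
    ℕP.≤-trans (ℕP.≤-reflexive (P.cong suc eq)) (ℕP.≤-trans (s≤s (s≤s (StrictDec⇒nth+j< sL j<l))) 1+n<i)
    where
    eq : nth L j ℕ.+ 1 ℕ.+ suc j ≡ suc (suc (nth L j ℕ.+ j))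
    eq = solve 2 (λ a j → a :+ con 1 :+ (con 1 :+ j) := con 2 :+ (a :+ j)) P.refl (nth L j) j
      where open +-*-Solver

frobPart-cons : ∀ {n L} → StrictDec n L → ∀ {i} → 1 ℕ.≤ i → i ℕ.≤ suc n →
  frobPart (n ∷ L) (suc i) ≡ suc (frobPart L i)
frobPart-cons {n} {L} sL {suc i} _ (s≤s i≤n) with suc i ℕ.≤? length L
... | yes i<l = begin
  frobPart (n ∷ L) (suc (suc i))  ≡⟨ frobPart-inside (n ∷ L) (s≤s i<l) ⟩
  nth L i ℕ.+ suc (suc i)         ≡⟨ ℕP.+-suc (nth L i) (suc i) ⟩
  suc (nth L i ℕ.+ suc i)         ≡⟨ P.cong suc (frobPart-inside L i<l) ⟨
  suc (frobPart L (suc i))        ∎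
  where open P.≡-Reasoning
... | no i≮l = begin
  frobPart (n ∷ L) (suc (suc i))
    ≡⟨ frobPart-outside (n ∷ L) (s≤s l<i) ⟩
  countUpTo (suc (length L)) g (suc (suc i))
    ≡⟨ countUpTo-first (length L) g (suc (suc i)) 2+i≤g1 ⟩
  suc (countUpTo (length L) (λ j → g (suc j)) (suc (suc i)))
    ≡⟨ P.cong suc (countUpTo-cong (length L) (suc (suc i)) shift) ⟩
  suc (countUpTo (length L) (λ j → suc (h j)) (suc (suc i)))
    ≡⟨ P.cong suc (countUpTo-suc (length L) h (suc i)) ⟩
  suc (countUpTo (length L) h (suc i))
    ≡⟨ P.cong suc (frobPart-outside L l<i) ⟨
  suc (frobPart L (suc i)) ∎
  where
  open P.≡-Reasoning
  open +-*-Solver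
  l<i : length L ℕ.< suc i
  l<i = ℕP.≰⇒> i≮l
  g h : ℕ → ℕ
  g j = nth (n ∷ L) (j ∸ 1) ℕ.+ 1 ℕ.+ j
  h j = nth L (j ∸ 1) ℕ.+ 1 ℕ.+ j
  2+i≤g1 : suc (suc i) ℕ.≤ g 1
  2+i≤g1 = P.subst (suc (suc i) ℕ.≤_) (solve 1 (λ n → con 2 :+ n := n :+ con 1 :+ con 1) P.refl n) (s≤s (s≤s i≤n))
  shift : ∀ j → 1 ℕ.≤ j → j ℕ.≤ length L → g (suc j) ≡ suc (h j)
  shift (suc j) _ _ = ℕP.+-suc (nth L j ℕ.+ 1) (suc j)

sizeUpTo-beyond : ∀ {n L} → StrictDec n L → sizeUpTo (suc (suc n)) L ≡ sizeUpTo (suc n) L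
sizeUpTo-beyond {n} {L} sL =
  P.trans (P.cong (sizeUpTo (suc n) L ℕ.+_) (frobPart-beyond sL ℕP.≤-refl)) (ℕP.+-identityʳ _)

sizeUpTo-cons : ∀ {n L} → StrictDec n L →
  sizeUpTo (suc (suc n)) (n ∷ L) ≡ (suc n ℕ.+ suc n) ℕ.+ sizeUpTo (suc n) L
sizeUpTo-cons {n} {L} sL =
  P.trans (upTo (suc n) ℕP.≤-refl)
    (solve 2 (λ n s → n :+ (s :+ n) := (n :+ n) :+ s) P.refl (suc n) (sizeUpTo (suc n) L))
  where
  open +-*-Solver
  upTo : ∀ m → m ℕ.≤ suc n → sizeUpTo (suc m) (n ∷ L) ≡ suc n ℕ.+ (sizeUpTo m L ℕ.+ m)
  upTo zero    _   = P.trans (ℕP.+-comm n 1) (P.sym (ℕP.+-identityʳ _))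
  upTo (suc m) m<n =
    P.trans (P.cong₂ ℕ._+_ (upTo m (ℕP.<⇒≤ m<n)) (frobPart-cons sL (s≤s z≤n) m<n))
      (solve 4 (λ n s f m → (n :+ (s :+ m)) :+ (con 1 :+ f) := n :+ ((s :+ f) :+ (con 1 :+ m))) P.refl
        (suc n) (sizeUpTo m L) (frobPart L (suc m)) m)

⌊m+[n+n]/2⌋≡⌊m/2⌋+n : ∀ m n → ⌊ m ℕ.+ (n ℕ.+ n) /2⌋ ≡ ⌊ m /2⌋ ℕ.+ n
⌊m+[n+n]/2⌋≡⌊m/2⌋+n m zero    = P.trans (P.cong ⌊_/2⌋ (ℕP.+-identityʳ m)) (P.sym (ℕP.+-identityʳ _))
⌊m+[n+n]/2⌋≡⌊m/2⌋+n m (suc n) = begin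
  ⌊ m ℕ.+ (suc n ℕ.+ suc n) /2⌋
    ≡⟨ P.cong ⌊_/2⌋ (solve 2 (λ m n → m :+ ((con 1 :+ n) :+ (con 1 :+ n)) := con 2 :+ (m :+ (n :+ n))) P.refl m n) ⟩
  suc ⌊ m ℕ.+ (n ℕ.+ n) /2⌋  ≡⟨ P.cong suc (⌊m+[n+n]/2⌋≡⌊m/2⌋+n m n) ⟩
  suc (⌊ m /2⌋ ℕ.+ n)        ≡⟨ ℕP.+-suc ⌊ m /2⌋ n ⟨
  ⌊ m /2⌋ ℕ.+ suc n          ∎
  where open P.≡-Reasoning; open +-*-Solver

[1+n]C2≡n+nC2 : ∀ n → suc n C 2 ≡ n ℕ.+ n C 2
[1+n]C2≡n+nC2 n = P.trans (P.sym (ℕC.nCk+nC[k+1]≡[n+1]C[k+1] n 1)) (P.cong (ℕ._+ n C 2) (ℕC.nC1≡n n))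

module _ {c ℓ : Level} (R : CommutativeRing c ℓ) where
  open CommutativeRing R hiding (zero)
  open WithRing R
  open Exp commutativeSemiring using (_^_; ^-congˡ; ^-homo-*; ^-distrib-*)
  open NaturalSolver commutativeSemiring using (solve; _:=_; _:+_; _:*_; con)
  open RingProperties ring using (-1*x≈-x; -‿distribˡ-*; -‿distribʳ-*)
  open GroupProperties +-group using (inverseˡ-unique; ε⁻¹≈ε)
  open import Relation.Binary.Reasoning.Setoid setoid

  pow≡^ : ∀ y n → pow y n ≡ y ^ n
  pow≡^ y zero    = P.refl
  pow≡^ y (suc n) = P.cong (y *_) (pow≡^ y n)

  pow-cong : ∀ {y z} n → y ≈ z → pow y n ≈ pow z n
  pow-cong {y} {z} n y≈z rewrite pow≡^ y n | pow≡^ z n = ^-congˡ n y≈z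

  pow-+ : ∀ y m n → pow y (m ℕ.+ n) ≈ pow y m * pow y n
  pow-+ y m n rewrite pow≡^ y (m ℕ.+ n) | pow≡^ y m | pow≡^ y n = ^-homo-* y m n

  pow-distrib-* : ∀ y z n → pow (y * z) n ≈ pow y n * pow z n
  pow-distrib-* y z n rewrite pow≡^ (y * z) n | pow≡^ y n | pow≡^ z n = ^-distrib-* y z n

  pow-1# : ∀ n → pow 1# n ≈ 1#
  pow-1# zero    = refl
  pow-1# (suc n) = trans (*-identityˡ _) (pow-1# n)

  pow-inverse : ∀ {y z} → y * z ≈ 1# → ∀ n → pow y n * pow z n ≈ 1#
  pow-inverse {y} {z} yz≈1 n = trans (sym (pow-distrib-* y z n)) (trans (pow-cong n yz≈1) (pow-1# n))

  sign : ℕ → Carrier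
  sign = pow (- 1#)

  sign-+ : ∀ m n → sign (m ℕ.+ n) ≈ sign m * sign n
  sign-+ = pow-+ (- 1#)

  sign-suc : ∀ n → sign (suc n) ≈ - sign n
  sign-suc n = -1*x≈-x (sign n)

  sign*sign : ∀ n → sign n * sign n ≈ 1#
  sign*sign = pow-inverse (trans (-1*x≈-x (- 1#)) (GroupProperties.⁻¹-involutive +-group 1#))

  sign-combine : ∀ E n X Y →
    sign ⌊ E /2⌋ * (sign (n C 2) * X) + sign ⌊ E ℕ.+ (n ℕ.+ n) /2⌋ * (sign (n C 2) * Y)
      ≈ sign ⌊ E /2⌋ * (sign (suc n C 2) * (sign n * X + Y))
  sign-combine E n X Y = begin
    s * (σ * X) + sign ⌊ E ℕ.+ (n ℕ.+ n) /2⌋ * (σ * Y)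
      ≈⟨ +-cong (sym (trans (*-cong (sign*sign n) refl) (*-identityˡ _)))
                (*-cong (trans (reflexive (P.cong sign (⌊m+[n+n]/2⌋≡⌊m/2⌋+n E n))) (sign-+ ⌊ E /2⌋ n)) refl) ⟩
    (z * z) * (s * (σ * X)) + (s * z) * (σ * Y)
      ≈⟨ solve 5 (λ s z c a b → (z :* z) :* (s :* (c :* a)) :+ (s :* z) :* (c :* b) := s :* ((z :* c) :* (z :* a :+ b)))
           refl s z σ X Y ⟩
    s * ((z * σ) * (z * X + Y))
      ≈⟨ *-cong refl (*-cong (trans (sym (sign-+ n (n C 2))) (reflexive (P.cong sign (P.sym ([1+n]C2≡n+nC2 n))))) refl) ⟩
    s * (sign (suc n C 2) * (z * X + Y)) ∎
    where
    s = sign ⌊ E /2⌋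
    z = sign n
    σ = sign (n C 2)

  sumFin-cong : ∀ n {f g : Fin n → Carrier} → (∀ j → f j ≈ g j) → sumFin n f ≈ sumFin n g
  sumFin-cong zero    f≈g = refl
  sumFin-cong (suc n) f≈g = +-cong (f≈g zero) (sumFin-cong n (λ j → f≈g (suc j)))

  sumFin-*ˡ : ∀ n u (f : Fin n → Carrier) → sumFin n (λ j → u * f j) ≈ u * sumFin n f
  sumFin-*ˡ zero    u f = sym (zeroʳ u)
  sumFin-*ˡ (suc n) u f = trans (+-cong refl (sumFin-*ˡ n u _)) (sym (distribˡ _ _ _))

  sumFin-linear : ∀ n u v (f g : Fin n → Carrier) →
    sumFin n (λ j → u * f j + v * g j) ≈ u * sumFin n f + v * sumFin n g
  sumFin-linear zero    u v f g = sym (trans (+-cong (zeroʳ u) (zeroʳ v)) (+-identityˡ 0#))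
  sumFin-linear (suc n) u v f g = trans (+-cong refl (sumFin-linear n u v _ _))
    (solve 6 (λ u v a b x y → ((u :* a) :+ (v :* b)) :+ ((u :* x) :+ (v :* y)) := (u :* (a :+ x)) :+ (v :* (b :+ y)))
       refl u v (f zero) (g zero) (sumFin n (λ j → f (suc j))) (sumFin n (λ j → g (suc j))))

  sumFin-zero : ∀ n {f : Fin n → Carrier} → (∀ j → f j ≈ 0#) → sumFin n f ≈ 0#
  sumFin-zero zero    f≈0 = refl
  sumFin-zero (suc n) f≈0 = trans (+-cong (f≈0 zero) (sumFin-zero n (λ j → f≈0 (suc j)))) (+-identityˡ _)

  sumFin-adjacent-cancel : ∀ n (f : Fin n → Carrier) (a b : Fin n) → toℕ b ≡ suc (toℕ a) →
    (∀ k → k ≢ a → k ≢ b → f k ≈ 0#) → f a + f b ≈ 0# → sumFin n f ≈ 0#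
  sumFin-adjacent-cancel (suc (suc n)) f zero (suc zero) _ others fa+fb≈0 =
    trans (sym (+-assoc _ _ _))
      (trans (+-cong fa+fb≈0 (sumFin-zero n (λ j → others (suc (suc j)) (λ ()) (λ ())))) (+-identityˡ _))
  sumFin-adjacent-cancel (suc n) f (suc a) (suc b) b≡1+a others fa+fb≈0 =
    trans (+-cong (others zero (λ ()) (λ ()))
                  (sumFin-adjacent-cancel n (λ j → f (suc j)) a b (ℕP.suc-injective b≡1+a)
                    (λ k k≢a k≢b → others (suc k) (k≢a ∘ FinP.suc-injective) (k≢b ∘ FinP.suc-injective)) fa+fb≈0))
          (+-identityˡ _)

  sumList-cong : {A : Set} (xs : List A) {f g : A → Carrier} → (∀ a → f a ≈ g a) → sumList xs f ≈ sumList xs g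
  sumList-cong []       f≈g = refl
  sumList-cong (x ∷ xs) f≈g = +-cong (f≈g x) (sumList-cong xs f≈g)

  sumList-cong-All : {A : Set} {Q : A → Set} {xs : List A} → All Q xs → {f g : A → Carrier} →
    (∀ a → Q a → f a ≈ g a) → sumList xs f ≈ sumList xs g
  sumList-cong-All []         f≈g = refl
  sumList-cong-All (qx ∷ qxs) f≈g = +-cong (f≈g _ qx) (sumList-cong-All qxs f≈g)

  sumList-++ : {A : Set} (xs ys : List A) (f : A → Carrier) → sumList (xs ++ ys) f ≈ sumList xs f + sumList ys f
  sumList-++ []       ys f = sym (+-identityˡ _)
  sumList-++ (x ∷ xs) ys f = trans (+-cong refl (sumList-++ xs ys f)) (sym (+-assoc _ _ _))

  sumList-map : {A B : Set} (g : A → B) (xs : List A) (f : B → Carrier) →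
    sumList (map g xs) f ≈ sumList xs (λ a → f (g a))
  sumList-map g []       f = refl
  sumList-map g (x ∷ xs) f = +-cong refl (sumList-map g xs f)

  sumList-*ˡ : {A : Set} (xs : List A) (u : Carrier) (f : A → Carrier) → sumList xs (λ a → u * f a) ≈ u * sumList xs f
  sumList-*ˡ []       u f = sym (zeroʳ u)
  sumList-*ˡ (x ∷ xs) u f = trans (+-cong refl (sumList-*ˡ xs u f)) (sym (distribˡ _ _ _))

  module Inverses {a b : Carrier} (ab≈1 : a * b ≈ 1#) where
    pow-cancel : ∀ k m → pow a (k ℕ.+ m) * pow b k ≈ pow a m
    pow-cancel zero    m = *-identityʳ _
    pow-cancel (suc k) m = begin
      (a * pow a (k ℕ.+ m)) * (b * pow b k)   ≈⟨ solve 4 (λ a b x y → (a :* x) :* (b :* y) := (a :* b) :* (x :* y))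
                                                           refl a b _ _ ⟩
      (a * b) * (pow a (k ℕ.+ m) * pow b k)   ≈⟨ *-cong ab≈1 (pow-cancel k m) ⟩
      1# * pow a m                            ≈⟨ *-identityˡ _ ⟩
      pow a m                                 ∎

    pow-+-inverse : ∀ k m → pow a (k ℕ.+ m) * pow (a + b) k ≈ pow a m * pow (1# + a * a) k
    pow-+-inverse zero    m = refl
    pow-+-inverse (suc k) m = begin
      (a * pow a (k ℕ.+ m)) * ((a + b) * pow (a + b) k)
        ≈⟨ solve 4 (λ a b x y → (a :* x) :* ((a :+ b) :* y) := (a :* a :+ a :* b) :* (x :* y)) refl a b _ _ ⟩
      (a * a + a * b) * (pow a (k ℕ.+ m) * pow (a + b) k)
        ≈⟨ *-cong (trans (+-cong refl ab≈1) (+-comm _ _)) (pow-+-inverse k m) ⟩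
      (1# + a * a) * (pow a m * pow (1# + a * a) k)
        ≈⟨ solve 3 (λ u v w → u :* (v :* w) := v :* (u :* w)) refl _ _ _ ⟩
      pow a m * pow (1# + a * a) (suc k) ∎

    pow-∸-inverse : ∀ e k → k ℕ.≤ e → pow a (e ∸ k) * pow (1# + a * a) k ≈ pow a e * pow (a + b) k
    pow-∸-inverse e k k≤e = P.subst (λ z → pow a (e ∸ k) * pow (1# + a * a) k ≈ pow a z * pow (a + b) k)
      (ℕP.m+[n∸m]≡n k≤e) (sym (pow-+-inverse k (e ∸ k)))

    zpow-⊖ : ∀ m n → zpow a b (m ℤ.⊖ n) ≈ pow a m * pow b n
    zpow-⊖ m       zero    rewrite ℤP.⊖-≥ {m} {0} z≤n = sym (*-identityʳ _)
    zpow-⊖ zero    (suc n) = sym (*-identityˡ _)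
    zpow-⊖ (suc m) (suc n) rewrite ℤP.[1+m]⊖[1+n]≡m⊖n m n = begin
      zpow a b (m ℤ.⊖ n)                      ≈⟨ zpow-⊖ m n ⟩
      pow a m * pow b n                       ≈⟨ *-identityˡ _ ⟨
      1# * (pow a m * pow b n)                ≈⟨ *-cong ab≈1 refl ⟨
      (a * b) * (pow a m * pow b n)           ≈⟨ solve 4 (λ a b x y → (a :* b) :* (x :* y) := (a :* x) :* (b :* y))
                                                           refl a b _ _ ⟩
      pow a (suc m) * pow b (suc n)           ∎

    zpow-− : ∀ m n → zpow a b (+ m ℤ.- + n) ≈ pow a m * pow b n
    zpow-− m n rewrite ℤP.m-n≡m⊖n m n = zpow-⊖ m n

    W-entry₁ : ∀ p k → k ℕ.< p →
      pow a (p ∸ 1 ∸ k) * pow (1# + a * a) k ≈ zpow a b (+ p ℤ.- + 1) * pow (a + b) k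
    W-entry₁ (suc p) k (s≤s k≤p) = begin
      pow a (p ∸ k) * pow (1# + a * a) k         ≈⟨ pow-∸-inverse p k k≤p ⟩
      pow a p * pow (a + b) k                    ≈⟨ *-cong (pow-cancel 1 p) refl ⟨
      (pow a (suc p) * pow b 1) * pow (a + b) k  ≈⟨ *-cong (zpow-− (suc p) 1) refl ⟨
      zpow a b (+ suc p ℤ.- + 1) * pow (a + b) k ∎

    W-entry₂ : ∀ p q l c → l ℕ.< q →
      c * (pow a (q ∸ 1 ∸ l) * pow (1# + a * a) l) ≈ zpow a b (+ p ℤ.- + 1) * ((c * zpow a b (+ q ℤ.- + p)) * pow (a + b) l)
    W-entry₂ p (suc q) l c (s≤s l≤q) = begin
      c * (pow a (q ∸ l) * pow (1# + a * a) l)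
        ≈⟨ *-cong refl (pow-∸-inverse q l l≤q) ⟩
      c * (pow a q * Y)
        ≈⟨ *-cong refl (*-cong (sym (pow-cancel 1 q)) (sym (trans (*-cong (pow-inverse ab≈1 p) refl) (*-identityˡ _)))) ⟩
      c * ((pow a (suc q) * pow b 1) * ((pow a p * pow b p) * Y))
        ≈⟨ solve 6 (λ c Aq B1 Ap Bp Y → c :* ((Aq :* B1) :* ((Ap :* Bp) :* Y)) := (Ap :* B1) :* ((c :* (Aq :* Bp)) :* Y))
             refl c (pow a (suc q)) (pow b 1) (pow a p) (pow b p) Y ⟩
      (pow a p * pow b 1) * ((c * (pow a (suc q) * pow b p)) * Y)
        ≈⟨ *-cong (sym (zpow-− p 1)) (*-cong (*-cong refl (sym (zpow-− (suc q) p))) refl) ⟩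
      zpow a b (+ p ℤ.- + 1) * ((c * zpow a b (+ suc q ℤ.- + p)) * Y) ∎
      where
      Y = pow (a + b) l

  -- Determinants

  Matrix : ℕ → Set c
  Matrix n = Fin n → Fin n → Carrier

  minor : ∀ {n} → Fin (suc n) → Matrix (suc n) → Matrix n
  minor j M r k = M (suc r) (punchIn j k)

  cofactorTerm : ∀ {n} → Matrix (suc n) → Fin (suc n) → Carrier
  cofactorTerm {n} M j = sign (toℕ j) * (M zero j * det n (minor j M))

  det-cong : ∀ n {M N : Matrix n} → (∀ r k → M r k ≈ N r k) → det n M ≈ det n N
  det-cong zero    M≈N = refl
  det-cong (suc n) {M} {N} M≈N = sumFin-cong (suc n) {cofactorTerm M} {cofactorTerm N} (λ j →
    *-cong refl (*-cong (M≈N zero j) (det-cong n (λ r k → M≈N (suc r) (punchIn j k)))))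

  det-scaleRows : ∀ n (d : Fin n → Carrier) (M : Matrix n) →
    det n (λ r k → d r * M r k) ≈ prodFin n d * det n M
  det-scaleRows zero    d M = sym (*-identityˡ _)
  det-scaleRows (suc n) d M = begin
    sumFin (suc n) (λ j → sign (toℕ j) * ((d zero * M zero j) * det n (λ r k → d (suc r) * minor j M r k)))
      ≈⟨ sumFin-cong (suc n) {g = λ j → sign (toℕ j) * ((d zero * M zero j) * (prodFin n (d ∘ suc) * det n (minor j M)))}
           (λ j → *-cong refl (*-cong refl (det-scaleRows n (d ∘ suc) (minor j M)))) ⟩
    sumFin (suc n) (λ j → sign (toℕ j) * ((d zero * M zero j) * (prodFin n (d ∘ suc) * det n (minor j M))))
      ≈⟨ sumFin-cong (suc n) (λ j → solve 5 (λ s a b m x → s :* ((a :* m) :* (b :* x)) := (a :* b) :* (s :* (m :* x)))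
           refl (sign (toℕ j)) (d zero) (prodFin n (d ∘ suc)) (M zero j) (det n (minor j M))) ⟩
    sumFin (suc n) (λ j → (d zero * prodFin n (d ∘ suc)) * cofactorTerm M j)
      ≈⟨ sumFin-*ˡ (suc n) _ (cofactorTerm M) ⟩
    (d zero * prodFin n (d ∘ suc)) * det (suc n) M ∎

  det-linear : ∀ n (M A B : Matrix n) (t : Fin n) u v →
    (∀ r → M r t ≈ u * A r t + v * B r t) →
    (∀ r k → k ≢ t → M r k ≈ A r k) → (∀ r k → k ≢ t → M r k ≈ B r k) →
    det n M ≈ u * det n A + v * det n B
  det-linear (suc n) M A B t u v Mt M≈A M≈B =
    trans (sumFin-cong (suc n) term) (sumFin-linear (suc n) u v (cofactorTerm A) (cofactorTerm B))
    where
    term : ∀ j → cofactorTerm M j ≈ u * cofactorTerm A j + v * cofactorTerm B j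
    term j with j Fin.≟ t
    ... | yes P.refl = begin
      sign (toℕ j) * (M zero j * det n (minor j M))
        ≈⟨ *-cong refl (*-cong (Mt zero) refl) ⟩
      sign (toℕ j) * ((u * A zero j + v * B zero j) * det n (minor j M))
        ≈⟨ solve 6 (λ s u v a b d → s :* ((u :* a :+ v :* b) :* d) := u :* (s :* (a :* d)) :+ v :* (s :* (b :* d)))
             refl (sign (toℕ j)) u v (A zero j) (B zero j) (det n (minor j M)) ⟩
      u * (sign (toℕ j) * (A zero j * det n (minor j M))) + v * (sign (toℕ j) * (B zero j * det n (minor j M)))
        ≈⟨ +-cong (*-cong refl (*-cong refl (*-cong refl (minor-cong M≈A))))
                  (*-cong refl (*-cong refl (*-cong refl (minor-cong M≈B)))) ⟩
      u * cofactorTerm A j + v * cofactorTerm B j ∎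
      where
      minor-cong : ∀ {N} → (∀ r k → k ≢ t → M r k ≈ N r k) → det n (minor j M) ≈ det n (minor j N)
      minor-cong M≈N = det-cong n (λ r k → M≈N (suc r) (punchIn j k) (FinP.punchInᵢ≢i j k))
    ... | no j≢t = begin
      sign (toℕ j) * (M zero j * det n (minor j M))
        ≈⟨ *-cong refl (*-cong refl minor-linear) ⟩
      sign (toℕ j) * (M zero j * (u * det n (minor j A) + v * det n (minor j B)))
        ≈⟨ solve 6 (λ s u v m a b → s :* (m :* (u :* a :+ v :* b)) := u :* (s :* (m :* a)) :+ v :* (s :* (m :* b)))
             refl (sign (toℕ j)) u v (M zero j) (det n (minor j A)) (det n (minor j B)) ⟩
      u * (sign (toℕ j) * (M zero j * det n (minor j A))) + v * (sign (toℕ j) * (M zero j * det n (minor j B)))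
        ≈⟨ +-cong (*-cong refl (*-cong refl (*-cong (M≈A zero j j≢t) refl)))
                  (*-cong refl (*-cong refl (*-cong (M≈B zero j j≢t) refl))) ⟩
      u * cofactorTerm A j + v * cofactorTerm B j ∎
      where
      t′ = Fin.punchOut j≢t
      punchIn-t′ : punchIn j t′ ≡ t
      punchIn-t′ = FinP.punchIn-punchOut j≢t
      off-t′ : ∀ {N} → (∀ r k → k ≢ t → M r k ≈ N r k) → ∀ r k → k ≢ t′ → minor j M r k ≈ minor j N r k
      off-t′ M≈N r k k≢t′ = M≈N (suc r) (punchIn j k)
        (λ eq → k≢t′ (FinP.punchIn-injective j k t′ (P.trans eq (P.sym punchIn-t′))))
      minor-linear : det n (minor j M) ≈ u * det n (minor j A) + v * det n (minor j B)
      minor-linear = det-linear n (minor j M) (minor j A) (minor j B) t′ u v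
        (λ r → P.subst (λ z → M (suc r) z ≈ u * A (suc r) z + v * B (suc r) z) (P.sym punchIn-t′) (Mt (suc r)))
        (off-t′ M≈A) (off-t′ M≈B)

  punchIn-adjacent : ∀ {n} (k a b : Fin (suc n)) → toℕ b ≡ suc (toℕ a) → k ≢ a → k ≢ b →
    Σ[ a′ ∈ Fin n ] Σ[ b′ ∈ Fin n ] punchIn k a′ ≡ a × punchIn k b′ ≡ b × toℕ b′ ≡ suc (toℕ a′)
  punchIn-adjacent zero zero b _ k≢a _ = ⊥-elim (k≢a P.refl)
  punchIn-adjacent zero (suc a) (suc b) b≡1+a _ _ = a , b , P.refl , P.refl , ℕP.suc-injective b≡1+a
  punchIn-adjacent {suc n} (suc zero) zero (suc zero) _ _ k≢b = ⊥-elim (k≢b P.refl)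
  punchIn-adjacent {suc (suc n)} (suc (suc k)) zero (suc zero) _ _ _ = zero , suc zero , P.refl , P.refl , P.refl
  punchIn-adjacent {suc n} (suc k) (suc a) (suc b) b≡1+a k≢a k≢b
    with punchIn-adjacent k a b (ℕP.suc-injective b≡1+a) (k≢a ∘ P.cong suc) (k≢b ∘ P.cong suc)
  ... | a′ , b′ , a′↦a , b′↦b , b′≡1+a′ =
    suc a′ , suc b′ , P.cong suc a′↦a , P.cong suc b′↦b , P.cong suc b′≡1+a′

  punchIn-adjacent-swap : ∀ {n} (a b : Fin (suc n)) → toℕ b ≡ suc (toℕ a) → ∀ k →
    punchIn a k ≡ punchIn b k ⊎ (punchIn a k ≡ b × punchIn b k ≡ a)
  punchIn-adjacent-swap zero    (suc zero) _ zero    = inj₂ (P.refl , P.refl)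
  punchIn-adjacent-swap zero    (suc zero) _ (suc k) = inj₁ P.refl
  punchIn-adjacent-swap (suc a) (suc b)    _ zero    = inj₁ P.refl
  punchIn-adjacent-swap (suc a) (suc b) b≡1+a (suc k) with punchIn-adjacent-swap a b (ℕP.suc-injective b≡1+a) k
  ... | inj₁ eq         = inj₁ (P.cong suc eq)
  ... | inj₂ (eqa , eqb) = inj₂ (P.cong suc eqa , P.cong suc eqb)

  det-adjacent : ∀ n (M : Matrix n) (a b : Fin n) → toℕ b ≡ suc (toℕ a) → (∀ r → M r a ≈ M r b) → det n M ≈ 0#
  det-adjacent (suc n) M a b b≡1+a Ma≈Mb = sumFin-adjacent-cancel (suc n) (cofactorTerm M) a b b≡1+a others pair
    where
    others : ∀ k → k ≢ a → k ≢ b → cofactorTerm M k ≈ 0#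
    others k k≢a k≢b with punchIn-adjacent k a b b≡1+a k≢a k≢b
    ... | a′ , b′ , P.refl , P.refl , b′≡1+a′ =
      trans (*-cong refl (*-cong refl (det-adjacent n (minor k M) a′ b′ b′≡1+a′ (λ r → Ma≈Mb (suc r)))))
            (trans (*-cong refl (zeroʳ _)) (zeroʳ _))
    minors≈ : ∀ r k → minor a M r k ≈ minor b M r k
    minors≈ r k with punchIn-adjacent-swap a b b≡1+a k
    ... | inj₁ eq         = reflexive (P.cong (M (suc r)) eq)
    ... | inj₂ (eqa , eqb) = P.subst₂ (λ z w → M (suc r) z ≈ M (suc r) w) (P.sym eqa) (P.sym eqb) (sym (Ma≈Mb (suc r)))
    pair : cofactorTerm M a + cofactorTerm M b ≈ 0#
    pair = begin
      sign (toℕ a) * (M zero a * det n (minor a M)) + sign (toℕ b) * (M zero b * det n (minor b M))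
        ≈⟨ +-cong refl (*-cong (reflexive (P.cong sign b≡1+a)) (*-cong (sym (Ma≈Mb zero)) (sym (det-cong n minors≈)))) ⟩
      sign (toℕ a) * (M zero a * det n (minor a M)) + sign (suc (toℕ a)) * (M zero a * det n (minor a M))
        ≈⟨ +-cong refl (trans (*-cong (sign-suc (toℕ a)) refl) (sym (-‿distribˡ-* _ _))) ⟩
      sign (toℕ a) * (M zero a * det n (minor a M)) + - (sign (toℕ a) * (M zero a * det n (minor a M)))
        ≈⟨ -‿inverseʳ _ ⟩
      0# ∎

  -- Alternating multilinear functions of column families

  module Alternating (N : ℕ) where
    Column : Set c
    Column = Fin N → Carrier

    Family : Set c
    Family = ℕ → Column

    infix 4 _≋_ _≋[_]_
    _≋_ : Column → Column → Set ℓ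
    u ≋ v = ∀ i → u i ≈ v i

    _≋[_]_ : Family → ℕ → Family → Set ℓ
    f ≋[ p ] g = ∀ k → k ℕ.< p → f k ≋ g k

    infixl 7 _·_
    infixl 6 _⊕_
    _·_ _⊕_ : Column → Column → Column
    (u · v) i = u i * v i
    (u ⊕ v) i = u i + v i

    ≡⇒≋ : ∀ {u v} → u ≡ v → u ≋ v
    ≡⇒≋ P.refl i = refl

    record IsAlternating (p : ℕ) (D : Family → Carrier) : Set (c ⊔ ℓ) where
      field
        alt-cong     : ∀ f g → f ≋[ p ] g → D f ≈ D g
        alt-linear   : ∀ f g h t → t ℕ.< p → ∀ u v → f t ≋ (λ i → u * g t i + v * h t i) →
                       (∀ k → k ≢ t → f k ≋ g k) → (∀ k → k ≢ t → f k ≋ h k) → D f ≈ u * D g + v * D h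
        alt-adjacent : ∀ f t → suc t ℕ.< p → f t ≋ f (suc t) → D f ≈ 0#
    open IsAlternating public

    cons : Column → Family → Family
    cons v f zero    = v
    cons v f (suc k) = f k

    cons-η : ∀ f k → cons (f 0) (f ∘ suc) k ≡ f k
    cons-η f zero    = P.refl
    cons-η f (suc k) = P.refl

    update : Family → ℕ → Column → Family
    update f t v k with k ℕ.≟ t
    ... | yes _ = v
    ... | no  _ = f k

    update-≡ : ∀ f t v → update f t v t ≡ v
    update-≡ f t v with t ℕ.≟ t
    ... | yes _   = P.refl
    ... | no  t≢t = ⊥-elim (t≢t P.refl)

    update-≢ : ∀ f {t} v {k} → k ≢ t → update f t v k ≡ f k
    update-≢ f {t} v {k} k≢t with k ℕ.≟ t
    ... | yes k≡t = ⊥-elim (k≢t k≡t)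
    ... | no  _   = P.refl

    prepend : ℕ → Family → Family → Family
    prepend zero    f g = g
    prepend (suc p) f g = cons (f 0) (prepend p (f ∘ suc) g)

    snoc : ℕ → Family → Column → Family
    snoc m f v = prepend m f (λ _ → v)

    snoc-≡ : ∀ m f v → snoc m f v m ≡ v
    snoc-≡ zero    f v = P.refl
    snoc-≡ (suc m) f v = snoc-≡ m (f ∘ suc) v

    prepend-< : ∀ p f g {k} → k ℕ.< p → prepend p f g k ≡ f k
    prepend-< (suc p) f g {zero}  _         = P.refl
    prepend-< (suc p) f g {suc k} (s≤s k<p) = prepend-< p (f ∘ suc) g k<p


    prepend-≋ : ∀ p {f f′} g k → (k ℕ.< p → f k ≋ f′ k) → prepend p f g k ≋ prepend p f′ g k
    prepend-≋ zero    g k       _      = λ i → refl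
    prepend-≋ (suc p) g zero    f≋f′ = f≋f′ (s≤s z≤n)
    prepend-≋ (suc p) g (suc k) f≋f′ = prepend-≋ p g k (f≋f′ ∘ s≤s)

    fixFirst : ∀ {p D} → IsAlternating (suc p) D → ∀ v → IsAlternating p (λ f → D (cons v f))
    fixFirst A v = record
      { alt-cong     = λ f g f≋g → alt-cong A (cons v f) (cons v g) λ
          { zero _ i → refl ; (suc k) (s≤s k<p) → f≋g k k<p }
      ; alt-linear   = λ f g h t t<p u w ft g-off h-off →
          alt-linear A (cons v f) (cons v g) (cons v h) (suc t) (s≤s t<p) u w ft
          (λ { zero _ i → refl ; (suc k) k≢t → g-off k (k≢t ∘ P.cong suc) })
          (λ { zero _ i → refl ; (suc k) k≢t → h-off k (k≢t ∘ P.cong suc) })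
      ; alt-adjacent = λ f t 1+t<p → alt-adjacent A (cons v f) (suc t) (s≤s 1+t<p)
      }

    fixPrefix : ∀ p {q D} → IsAlternating (p ℕ.+ q) D → ∀ f → IsAlternating q (λ g → D (prepend p f g))
    fixPrefix zero    A f = A
    fixPrefix (suc p) A f = fixPrefix p (fixFirst A (f 0)) (f ∘ suc)

    fixSuffix : ∀ {p m D} → p ℕ.≤ m → IsAlternating m D → ∀ g → IsAlternating p (λ f → D (prepend p f g))
    fixSuffix {p} p≤m A g = record
      { alt-cong     = λ f f′ f≋f′ → alt-cong A _ _ (λ k _ → prepend-≋ p g k (f≋f′ k))
      ; alt-linear   = λ f f₁ f₂ t t<p u v ft off₁ off₂ →
          alt-linear A _ _ _ t (ℕP.<-≤-trans t<p p≤m) u v (column t<p ft)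
            (λ k k≢t → prepend-≋ p g k (λ _ → off₁ k k≢t)) (λ k k≢t → prepend-≋ p g k (λ _ → off₂ k k≢t))
      ; alt-adjacent = λ f t 1+t<p ft≋ft+1 → alt-adjacent A _ t (ℕP.<-≤-trans 1+t<p p≤m) (adjacent f 1+t<p ft≋ft+1)
      }
      where
      column : ∀ {f f₁ f₂ t u v} → t ℕ.< p → f t ≋ (λ i → u * f₁ t i + v * f₂ t i) →
               prepend p f g t ≋ (λ i → u * prepend p f₁ g t i + v * prepend p f₂ g t i)
      column {f} {f₁} {f₂} t<p ft
        rewrite prepend-< p f g t<p | prepend-< p f₁ g t<p | prepend-< p f₂ g t<p = ft
      adjacent : ∀ f {t} → suc t ℕ.< p → f t ≋ f (suc t) → prepend p f g t ≋ prepend p f g (suc t)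
      adjacent f 1+t<p ft≋ft+1
        rewrite prepend-< p f g (ℕP.<-trans (ℕP.n<1+n _) 1+t<p) | prepend-< p f g 1+t<p = ft≋ft+1

    swap01 : ∀ {p D} → IsAlternating p D → 1 ℕ.< p → ∀ a b f → D (cons a (cons b f)) ≈ - D (cons b (cons a f))
    swap01 {p} {D} A 1<p a b f = inverseˡ-unique _ _ (begin
      D (cons a (cons b f)) + D (cons b (cons a f))
        ≈⟨ solve 2 (λ x y → x :+ y := con 1 :* (con 1 :* con 0 :+ con 1 :* x) :+ con 1 :* (con 1 :* y :+ con 1 :* con 0))
             refl (D (cons a (cons b f))) (D (cons b (cons a f))) ⟩
      1# * (1# * 0# + 1# * D (cons a (cons b f))) + 1# * (1# * D (cons b (cons a f)) + 1# * 0#)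
        ≈⟨ +-cong (*-cong refl (trans (+-cong (*-cong refl (sym (twice a))) refl) (sym (expand1 a))))
                  (*-cong refl (trans (+-cong refl (*-cong refl (sym (twice b)))) (sym (expand1 b)))) ⟩
      1# * D (cons a (cons s f)) + 1# * D (cons b (cons s f))
        ≈⟨ sym (alt-linear A (cons s (cons s f)) _ _ 0 (ℕP.<-trans (s≤s z≤n) 1<p) 1# 1# split (off0 a) (off0 b)) ⟩
      D (cons s (cons s f))
        ≈⟨ twice s ⟩
      0# ∎)
      where
      s : Column
      s i = a i + b i
      split : s ≋ (λ i → 1# * a i + 1# * b i)
      split i = sym (+-cong (*-identityˡ _) (*-identityˡ _))
      twice : ∀ x → D (cons x (cons x f)) ≈ 0#
      twice x = alt-adjacent A _ 0 1<p (λ i → refl)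
      off0 : ∀ x → ∀ k → k ≢ 0 → cons s (cons s f) k ≋ cons x (cons s f) k
      off0 x zero    k≢0 = ⊥-elim (k≢0 P.refl)
      off0 x (suc k) _   = λ i → refl
      off1 : ∀ x y → ∀ k → k ≢ 1 → cons x (cons s f) k ≋ cons x (cons y f) k
      off1 x y zero          _   = λ i → refl
      off1 x y (suc zero)    k≢1 = ⊥-elim (k≢1 P.refl)
      off1 x y (suc (suc k)) _   = λ i → refl
      expand1 : ∀ x → D (cons x (cons s f)) ≈ 1# * D (cons x (cons a f)) + 1# * D (cons x (cons b f))
      expand1 x = alt-linear A _ _ _ 1 1<p 1# 1# split (off1 x a) (off1 x b)

    snoc-rotate : ∀ m {D} → IsAlternating (suc m) D → ∀ f v → D (snoc m f v) ≈ sign m * D (cons v f)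
    snoc-rotate zero    A f v = trans (alt-cong A _ _ λ { zero _ i → refl ; (suc k) (s≤s ()) }) (sym (*-identityˡ _))
    snoc-rotate (suc m) {D} A f v = begin
      D (cons (f 0) (snoc m (f ∘ suc) v))            ≈⟨ snoc-rotate m (fixFirst A (f 0)) (f ∘ suc) v ⟩
      sign m * D (cons (f 0) (cons v (f ∘ suc)))     ≈⟨ *-cong refl (swap01 A (s≤s (s≤s z≤n)) (f 0) v (f ∘ suc)) ⟩
      sign m * - D (cons v (cons (f 0) (f ∘ suc)))   ≈⟨ *-cong refl (-‿cong (alt-cong A _ _ η)) ⟩
      sign m * - D (cons v f)                        ≈⟨ -‿distribʳ-* _ _ ⟨
      - (sign m * D (cons v f))                      ≈⟨ -‿distribˡ-* _ _ ⟩
      - sign m * D (cons v f)                        ≈⟨ *-cong (sign-suc m) refl ⟨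
      sign (suc m) * D (cons v f)                    ∎
      where
      η : cons v (cons (f 0) (f ∘ suc)) ≋[ suc (suc m) ] cons v f
      η zero    _ = λ i → refl
      η (suc k) _ = ≡⇒≋ (cons-η f k)

    equal-columns₀ : ∀ t {p D} → IsAlternating p D → ∀ f → 0 ℕ.< t → t ℕ.< p → f 0 ≋ f t → D f ≈ 0#
    equal-columns₀ (suc zero)    A f _ 1<p f0≋f1 = alt-adjacent A f 0 1<p f0≋f1
    equal-columns₀ (suc (suc t)) {suc p} {D} A f _ 2+t<p f0≋ft = begin
      D f                                 ≈⟨ alt-cong A _ _ (λ k _ → ≡⇒≋ (P.sym (η k))) ⟩
      D (cons (f 0) (cons (f 1) rest))    ≈⟨ swap01 A (ℕP.<-trans (s≤s (s≤s z≤n)) 2+t<p) (f 0) (f 1) rest ⟩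
      - D (cons (f 1) (cons (f 0) rest))
        ≈⟨ -‿cong (equal-columns₀ (suc t) (fixFirst A (f 1)) (cons (f 0) rest) (s≤s z≤n) (ℕP.≤-pred 2+t<p)
                                  f0≋ft) ⟩
      - 0#                                ≈⟨ ε⁻¹≈ε ⟩
      0#                                  ∎
      where
      rest : Family
      rest k = f (suc (suc k))
      η : ∀ k → cons (f 0) (cons (f 1) rest) k ≡ f k
      η zero          = P.refl
      η (suc zero)    = P.refl
      η (suc (suc k)) = P.refl

    equal-columns : ∀ s t {p D} → IsAlternating p D → ∀ f → s ℕ.< t → t ℕ.< p → f s ≋ f t → D f ≈ 0#
    equal-columns zero    t       A f 0<t t<p = equal-columns₀ t A f 0<t t<p
    equal-columns (suc s) (suc t) {suc p} A f (s≤s s<t) (s≤s t<p) fs≋ft =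
      trans (alt-cong A _ _ (λ k _ → ≡⇒≋ (P.sym (cons-η f k))))
            (equal-columns s t (fixFirst A (f 0)) (f ∘ suc) s<t t<p fs≋ft)

    update-linear : ∀ {p D} → IsAlternating p D → ∀ f t → t ℕ.< p → ∀ u v g h → f t ≋ (λ i → u * g i + v * h i) →
      D f ≈ u * D (update f t g) + v * D (update f t h)
    update-linear A f t t<p u v g h ft = alt-linear A f (update f t g) (update f t h) t t<p u v
      (λ i → trans (ft i) (+-cong (*-cong refl (sym (≡⇒≋ (update-≡ f t g) i)))
                                  (*-cong refl (sym (≡⇒≋ (update-≡ f t h) i)))))
      (λ k k≢t → ≡⇒≋ (P.sym (update-≢ f g k≢t))) (λ k k≢t → ≡⇒≋ (P.sym (update-≢ f h k≢t)))

    update-below : ∀ f {t} v {T} → f ≋[ t ] T → update f t v ≋[ t ] T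
    update-below f v f≋T k k<t i = trans (≡⇒≋ (update-≢ f v (ℕP.<⇒≢ k<t)) i) (f≋T k k<t i)

    data Span (T : Family) (k : ℕ) : Column → Set (c ⊔ ℓ) where
      span-gen  : ∀ m → m ℕ.< k → Span T k (T m)
      span-zero : Span T k (λ _ → 0#)
      span-+    : ∀ {u v} → Span T k u → Span T k v → Span T k (u ⊕ v)
      span-*    : ∀ {u} a → Span T k u → Span T k (λ i → a * u i)
      span-resp : ∀ {u v} → u ≋ v → Span T k u → Span T k v

    Span-mono : ∀ {T k k′ u} → k ℕ.≤ k′ → Span T k u → Span T k′ u
    Span-mono k≤k′ (span-gen m m<k)  = span-gen m (ℕP.<-≤-trans m<k k≤k′)
    Span-mono k≤k′ span-zero         = span-zero
    Span-mono k≤k′ (span-+ su sv)    = span-+ (Span-mono k≤k′ su) (Span-mono k≤k′ sv)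
    Span-mono k≤k′ (span-* a su)     = span-* a (Span-mono k≤k′ su)
    Span-mono k≤k′ (span-resp u≋v su) = span-resp u≋v (Span-mono k≤k′ su)

    span-column-zero : ∀ {T p D t u} → IsAlternating p D → Span T t u →
      ∀ f → t ℕ.< p → f ≋[ t ] T → f t ≋ u → D f ≈ 0#
    span-column-zero {t = t} A (span-gen m m<t) f t<p f≋T ft =
      equal-columns m t A f m<t t<p (λ i → trans (f≋T m m<t i) (sym (ft i)))
    span-column-zero {D = D} {t} A span-zero f t<p f≋T ft = begin
      D f                                    ≈⟨ update-linear A f t t<p 0# 0# u₀ u₀ (λ i → trans (ft i) (sym zeros)) ⟩
      0# * D (update f t u₀) + 0# * D (update f t u₀)  ≈⟨ zeros ⟩
      0#                                             ∎
      where
      u₀ : Column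
      u₀ _ = 0#
      zeros : ∀ {x y} → 0# * x + 0# * y ≈ 0#
      zeros = trans (+-cong (zeroˡ _) (zeroˡ _)) (+-identityˡ _)
    span-column-zero {D = D} {t} A (span-+ {u} {v} su sv) f t<p f≋T ft = begin
      D f
        ≈⟨ update-linear A f t t<p 1# 1# u v (λ i → trans (ft i) (sym (+-cong (*-identityˡ _) (*-identityˡ _)))) ⟩
      1# * D (update f t u) + 1# * D (update f t v)  ≈⟨ +-cong (*-cong refl (vanish su)) (*-cong refl (vanish sv)) ⟩
      1# * 0# + 1# * 0#                              ≈⟨ trans (+-cong (zeroʳ _) (zeroʳ _)) (+-identityˡ _) ⟩
      0#                                             ∎
      where
      vanish : ∀ {w} → Span _ t w → D (update f t w) ≈ 0#
      vanish {w} sw = span-column-zero A sw (update f t w) t<p (update-below f w f≋T) (≡⇒≋ (update-≡ f t w))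
    span-column-zero {D = D} {t} A (span-* {u} a su) f t<p f≋T ft = begin
      D f
        ≈⟨ update-linear A f t t<p a 0# u u (λ i → trans (ft i) (sym (trans (+-cong refl (zeroˡ _)) (+-identityʳ _)))) ⟩
      a * D (update f t u) + 0# * D (update f t u)   ≈⟨ +-cong (*-cong refl vanish) (zeroˡ _) ⟩
      a * 0# + 0#                                    ≈⟨ trans (+-identityʳ _) (zeroʳ a) ⟩
      0#                                             ∎
      where
      vanish : D (update f t u) ≈ 0#
      vanish = span-column-zero A su (update f t u) t<p (update-below f u f≋T) (≡⇒≋ (update-≡ f t u))
    span-column-zero A (span-resp u≋v su) f t<p f≋T ft =
      span-column-zero A su f t<p f≋T (λ i → trans (ft i) (sym (u≋v i)))

    splice : ℕ → Family → Family → Family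
    splice t f g k with k ℕ.<? t
    ... | yes _ = f k
    ... | no  _ = g k

    splice-< : ∀ t f g {k} → k ℕ.< t → splice t f g k ≡ f k
    splice-< t f g {k} k<t with k ℕ.<? t
    ... | yes _  = P.refl
    ... | no k≮t = ⊥-elim (k≮t k<t)

    splice-≮ : ∀ t f g {k} → ¬ k ℕ.< t → splice t f g k ≡ g k
    splice-≮ t f g {k} k≮t with k ℕ.<? t
    ... | yes k<t = ⊥-elim (k≮t k<t)
    ... | no _    = P.refl

    update-splice : ∀ t f g k → update (splice t f g) t (f t) k ≡ splice (suc t) f g k
    update-splice t f g k with k ℕ.≟ t
    ... | yes P.refl = P.sym (splice-< (suc t) f g ℕP.≤-refl)
    ... | no k≢t with k ℕ.<? t
    ...   | yes k<t = P.sym (splice-< (suc t) f g (ℕP.m<n⇒m<1+n k<t))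
    ...   | no k≮t  = P.sym (splice-≮ (suc t) f g (λ k<1+t → k≮t (ℕP.≤∧≢⇒< (ℕP.≤-pred k<1+t) k≢t)))

    triangular : ∀ {T p D} → IsAlternating p D → (W r : Family) → (∀ k → Span T k (r k)) →
      (∀ k → k ℕ.< p → W k ≋ T k ⊕ r k) → D W ≈ D T
    triangular {T} {p} {D} A W r r∈span W≋T+r =
      trans (alt-cong A _ _ (λ k _ → ≡⇒≋ (P.sym (splice-≮ 0 T W (λ ())))))
            (trans (chain p ℕP.≤-refl) (alt-cong A _ _ (λ k k<p → ≡⇒≋ (splice-< p T W k<p))))
      where
      step : ∀ t → t ℕ.< p → D (splice t T W) ≈ D (splice (suc t) T W)
      step t t<p = begin
        D (splice t T W)
          ≈⟨ update-linear A (splice t T W) t t<p 1# 1# (T t) (r t) column ⟩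
        1# * D (update (splice t T W) t (T t)) + 1# * D (update (splice t T W) t (r t))
          ≈⟨ +-cong (*-cong refl (alt-cong A _ _ (λ k _ → ≡⇒≋ (update-splice t T W k)))) (*-cong refl vanish) ⟩
        1# * D (splice (suc t) T W) + 1# * 0#
          ≈⟨ trans (+-cong (*-identityˡ _) (zeroʳ _)) (+-identityʳ _) ⟩
        D (splice (suc t) T W) ∎
        where
        column : splice t T W t ≋ (λ i → 1# * T t i + 1# * r t i)
        column i = trans (≡⇒≋ (splice-≮ t T W (ℕP.<-irrefl P.refl)) i)
                         (trans (W≋T+r t t<p i) (sym (+-cong (*-identityˡ _) (*-identityˡ _))))
        vanish : D (update (splice t T W) t (r t)) ≈ 0#
        vanish = span-column-zero A (r∈span t) _ t<p
          (update-below (splice t T W) (r t) (λ k k<t → ≡⇒≋ (splice-< t T W k<t))) (≡⇒≋ (update-≡ _ t (r t)))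
      chain : ∀ t → t ℕ.≤ p → D (splice 0 T W) ≈ D (splice t T W)
      chain zero    _     = refl
      chain (suc t) 1+t≤p = trans (chain t (ℕP.<⇒≤ 1+t≤p)) (step t 1+t≤p)

    module PowerBasis (T : Family) (y : Column)
        (recurrence : ∀ m → Σ[ r ∈ Column ] Span T m r × y · T m ≋ T (suc m) ⊕ r) where

      span-*y : ∀ {k u} → Span T k u → Span T (suc k) (y · u)
      span-*y {k} (span-gen m m<k) with recurrence m
      ... | r , r∈span , yTm≋ = span-resp (λ i → sym (yTm≋ i))
              (span-+ (span-gen (suc m) (s≤s m<k)) (Span-mono (ℕP.≤-trans (ℕP.<⇒≤ m<k) (ℕP.n≤1+n k)) r∈span))
      span-*y span-zero          = span-resp (λ i → sym (zeroʳ _)) span-zero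
      span-*y (span-+ su sv)     = span-resp (λ i → sym (distribˡ _ _ _)) (span-+ (span-*y su) (span-*y sv))
      span-*y (span-* a su)      = span-resp (λ i → solve 3 (λ a y u → a :* (y :* u) := y :* (a :* u)) refl a _ _)
                                     (span-* a (span-*y su))
      span-*y (span-resp u≋v su) = span-resp (λ i → *-cong refl (u≋v i)) (span-*y su)

      powers : ∀ k → Σ[ r ∈ Column ] Span T k r × (λ i → pow (y i) k * T 0 i) ≋ T k ⊕ r
      powers zero = (λ _ → 0#) , span-zero , λ i → trans (*-identityˡ _) (sym (+-identityʳ _))
      powers (suc k) with powers k | recurrence k
      ... | r , r∈span , yᵏT₀≋ | r′ , r′∈span , yTk≋ =
        r′ ⊕ y · r , span-+ (Span-mono (ℕP.n≤1+n k) r′∈span) (span-*y r∈span) , λ i → begin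
          (y i * pow (y i) k) * T 0 i      ≈⟨ *-assoc _ _ _ ⟩
          y i * (pow (y i) k * T 0 i)      ≈⟨ *-cong refl (yᵏT₀≋ i) ⟩
          y i * (T k i + r i)              ≈⟨ distribˡ _ _ _ ⟩
          y i * T k i + y i * r i          ≈⟨ +-cong (yTk≋ i) refl ⟩
          (T (suc k) i + r′ i) + y i * r i ≈⟨ +-assoc _ _ _ ⟩
          T (suc k) i + (r′ i + y i * r i) ∎

      powers-alternating : ∀ {p D} → IsAlternating p D → D (λ k i → pow (y i) k * T 0 i) ≈ D T
      powers-alternating A = triangular A _ (λ k → proj₁ (powers k)) (λ k → proj₁ (proj₂ (powers k)))
                                             (λ k _ → proj₂ (proj₂ (powers k)))

    module Chebyshev {x x⁻¹ : Column} (inverse : ∀ i → x i * x⁻¹ i ≈ 1#) (w : Column) where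
      y : Column
      y = x ⊕ x⁻¹

      laurent : ℕ → Column
      laurent zero    i = 1#
      laurent (suc m) i = pow (x i) (suc m) + pow (x⁻¹ i) (suc m)

      T : Family
      T m i = w i * laurent m i

      recurrence : ∀ m → Σ[ r ∈ Column ] Span T m r × y · T m ≋ T (suc m) ⊕ r
      recurrence zero = (λ _ → 0#) , span-zero , λ i → trans
        (solve 3 (λ a b w → (a :+ b) :* (w :* con 1) := w :* (a :* con 1 :+ b :* con 1)) refl (x i) (x⁻¹ i) (w i))
        (sym (+-identityʳ _))
      recurrence (suc zero) = T 0 ⊕ T 0 , span-+ (span-gen 0 (s≤s z≤n)) (span-gen 0 (s≤s z≤n)) , λ i →
        let a = x i ; b = x⁻¹ i in begin
        (a + b) * (w i * (a * 1# + b * 1#))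
          ≈⟨ solve 3 (λ a b w → (a :+ b) :* (w :* (a :* con 1 :+ b :* con 1))
                := w :* (a :* (a :* con 1) :+ b :* (b :* con 1)) :+ (w :* (a :* b) :+ w :* (a :* b))) refl a b (w i) ⟩
        w i * (a * (a * 1#) + b * (b * 1#)) + (w i * (a * b) + w i * (a * b))
          ≈⟨ +-cong refl (+-cong (*-cong refl (inverse i)) (*-cong refl (inverse i))) ⟩
        w i * (a * (a * 1#) + b * (b * 1#)) + (w i * 1# + w i * 1#) ∎
      recurrence (suc (suc m)) = T (suc m) , span-gen (suc m) ℕP.≤-refl , λ i →
        let a = x i ; b = x⁻¹ i ; A = pow a (suc m) ; B = pow b (suc m) in begin
        (a + b) * (w i * (a * A + b * B))
          ≈⟨ solve 5 (λ a b w A B → (a :+ b) :* (w :* (a :* A :+ b :* B))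
                := w :* (a :* (a :* A) :+ b :* (b :* B)) :+ w :* ((a :* b) :* A :+ (a :* b) :* B)) refl a b (w i) A B ⟩
        w i * (a * (a * A) + b * (b * B)) + w i * ((a * b) * A + (a * b) * B)
          ≈⟨ +-cong refl (*-cong refl (+-cong (trans (*-cong (inverse i) refl) (*-identityˡ _))
                                              (trans (*-cong (inverse i) refl) (*-identityˡ _)))) ⟩
        w i * (a * (a * A) + b * (b * B)) + w i * (A + B) ∎

      open PowerBasis T y recurrence public using (powers-alternating)

    -- The sum over 𝒫_p

    powerColumns : ℕ → List ℕ → Column → Column → Family
    powerColumns p L w x k i = w i * pow (x i) (frobPart L (p ∸ k) ℕ.+ k)

    -- z^{p-1} (z^k + z^{-k}) for 0 < k < p, and z^{p-1} for k = 0, written without inverses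
    balancedPow : ℕ → ℕ → Carrier → Carrier
    balancedPow p zero    z = pow z (p ∸ 1)
    balancedPow p (suc k) z = pow z (p ∸ 1 ∸ suc k) + pow z (suc k) * pow z (p ∸ 1)

    balancedColumns : ℕ → Column → Column → Family
    balancedColumns p w x k i = w i * balancedPow p k (x i)

    hookColumn : ℕ → Column → Column → Column
    hookColumn n w x = λ i → w i * pow (x i) (suc n ℕ.+ suc n)

    powerColumns-short : ∀ {n L} → StrictDec n L → ∀ w x →
      powerColumns (suc (suc n)) L w x ≋[ suc (suc n) ] cons w (powerColumns (suc n) L (w · x) x)
    powerColumns-short sL w x zero    _ i rewrite frobPart-beyond sL (ℕP.≤-refl {suc (suc _)}) = *-identityʳ _
    powerColumns-short {n} {L} sL w x (suc k) _ i rewrite ℕP.+-suc (frobPart L (suc n ∸ k)) k = sym (*-assoc _ _ _)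

    powerColumns-cons : ∀ {n L} → StrictDec n L → ∀ w x →
      powerColumns (suc (suc n)) (n ∷ L) w x
        ≋[ suc (suc n) ] snoc (suc n) (powerColumns (suc n) L (w · x) x) (hookColumn n w x)
    powerColumns-cons {n} {L} sL w x k k<2+n with k ℕ.≟ suc n
    ... | yes P.refl rewrite snoc-≡ (suc n) (powerColumns (suc n) L (w · x) x) (hookColumn n w x)
                           | ℕP.m+n∸n≡m 1 n | ℕP.+-comm n 1 = λ i → refl
    ... | no k≢1+n = below (ℕP.≤∧≢⇒< (ℕP.≤-pred k<2+n) k≢1+n)
      where
      below : k ℕ.< suc n → powerColumns (suc (suc n)) (n ∷ L) w x k
                ≋ snoc (suc n) (powerColumns (suc n) L (w · x) x) (hookColumn n w x) k
      below k<1+n rewrite prepend-< (suc n) (powerColumns (suc n) L (w · x) x) (λ _ → hookColumn n w x) k<1+n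
                        | ℕP.+-∸-assoc 1 (ℕP.<⇒≤ k<1+n)
                        | frobPart-cons sL (ℕP.m<n⇒0<n∸m k<1+n) (ℕP.m∸n≤m (suc n) k) = λ i → sym (*-assoc _ _ _)

    balancedPow-step : ∀ n k z → k ℕ.< suc n → balancedPow (suc (suc n)) k z ≈ z * balancedPow (suc n) k z
    balancedPow-step n zero    z _         = refl
    balancedPow-step n (suc k) z (s≤s k<n) rewrite ℕP.+-∸-assoc 1 k<n =
      solve 4 (λ z a b c → z :* a :+ b :* (z :* c) := z :* (a :+ b :* c))
        refl z (pow z (n ∸ suc k)) (pow z (suc k)) (pow z n)

    balancedPow-last : ∀ n z → balancedPow (suc (suc n)) (suc n) z ≈ 1# + pow z (suc n ℕ.+ suc n)
    balancedPow-last n z rewrite ℕP.n∸n≡0 n = +-cong refl (sym (pow-+ z (suc n) (suc n)))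

    update-snoc : ∀ m f a b → update (snoc m f a) m b ≋[ suc m ] snoc m f b
    update-snoc m f a b k k<1+m with k ℕ.≟ m
    ... | yes P.refl = ≡⇒≋ (P.sym (snoc-≡ m f b))
    ... | no k≢m rewrite prepend-< m f (λ _ → a) (ℕP.≤∧≢⇒< (ℕP.≤-pred k<1+m) k≢m)
                       | prepend-< m f (λ _ → b) (ℕP.≤∧≢⇒< (ℕP.≤-pred k<1+m) k≢m) = λ i → refl

    balancedColumns-split : ∀ n {D} → IsAlternating (suc (suc n)) D → ∀ w x →
      let G = balancedColumns (suc n) (w · x) x in
      D (balancedColumns (suc (suc n)) w x)
        ≈ sign (suc n) * D (cons w G) + D (snoc (suc n) G (hookColumn n w x))
    balancedColumns-split n {D} A w x = begin
      D (balancedColumns (suc (suc n)) w x)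
        ≈⟨ alt-cong A _ _ columns ⟩
      D (snoc (suc n) G (w ⊕ v))
        ≈⟨ update-linear A _ (suc n) ℕP.≤-refl 1# 1# w v (λ i → trans (≡⇒≋ (snoc-≡ (suc n) G _) i)
             (sym (+-cong (*-identityˡ _) (*-identityˡ _)))) ⟩
      1# * D (update (snoc (suc n) G _) (suc n) w) + 1# * D (update (snoc (suc n) G _) (suc n) v)
        ≈⟨ +-cong (trans (*-identityˡ _) (alt-cong A _ _ (update-snoc (suc n) G _ w)))
                  (trans (*-identityˡ _) (alt-cong A _ _ (update-snoc (suc n) G _ v))) ⟩
      D (snoc (suc n) G w) + D (snoc (suc n) G v)
        ≈⟨ +-cong (snoc-rotate (suc n) A G w) refl ⟩
      sign (suc n) * D (cons w G) + D (snoc (suc n) G v) ∎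
      where
      G = balancedColumns (suc n) (w · x) x
      v = hookColumn n w x
      columns : balancedColumns (suc (suc n)) w x ≋[ suc (suc n) ] snoc (suc n) G (w ⊕ v)
      columns k k<2+n with k ℕ.≟ suc n
      ... | yes P.refl rewrite snoc-≡ (suc n) G (w ⊕ v) =
        λ i → trans (*-cong refl (balancedPow-last n (x i))) (trans (distribˡ _ _ _) (+-cong (*-identityʳ _) refl))
      ... | no k≢1+n = below (ℕP.≤∧≢⇒< (ℕP.≤-pred k<2+n) k≢1+n)
        where
        below : k ℕ.< suc n → balancedColumns (suc (suc n)) w x k ≋ snoc (suc n) G (w ⊕ v) k
        below k<1+n rewrite prepend-< (suc n) G (λ _ → w ⊕ v) k<1+n =
          λ i → trans (*-cong refl (balancedPow-step n k (x i) k<1+n)) (sym (*-assoc _ _ _))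

    -- E is the part of the total partition size contributed from outside this block.
    sum-𝒫 : ∀ p {D} → IsAlternating p D → ∀ w x E →
      sumList (𝒫 p) (λ L → sign ⌊ E ℕ.+ sizeUpTo p L /2⌋ * D (powerColumns p L w x))
        ≈ sign ⌊ E /2⌋ * (sign (p C 2) * D (balancedColumns p w x))
    sum-𝒫 zero A w x E = trans (+-identityʳ _)
      (*-cong (reflexive (P.cong (sign ∘ ⌊_/2⌋) (ℕP.+-identityʳ E)))
              (trans (alt-cong A _ _ λ _ ()) (sym (*-identityˡ _))))
    sum-𝒫 (suc zero) A w x E = trans (+-identityʳ _)
      (*-cong (reflexive (P.cong (sign ∘ ⌊_/2⌋) (ℕP.+-identityʳ E)))
              (trans (alt-cong A _ _ λ { zero _ i → refl ; (suc k) (s≤s ()) }) (sym (*-identityˡ _))))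
    sum-𝒫 (suc (suc n)) {D} A w x E = begin
      sumList (strictDecs n ++ map (n ∷_) (strictDecs n)) term
        ≈⟨ sumList-++ (strictDecs n) _ term ⟩
      sumList (strictDecs n) term + sumList (map (n ∷_) (strictDecs n)) term
        ≈⟨ +-cong (sumList-cong-All (strictDecs-StrictDec n) short)
                  (trans (sumList-map (n ∷_) (strictDecs n) term) (sumList-cong-All (strictDecs-StrictDec n) hook)) ⟩
      sumList (𝒫 (suc n)) (λ L → sign ⌊ E ℕ.+ sizeUpTo (suc n) L /2⌋ * D (cons w (cols L)))
        + sumList (𝒫 (suc n)) (λ L → sign ⌊ E′ ℕ.+ sizeUpTo (suc n) L /2⌋ * D (snoc (suc n) (cols L) v))
        ≈⟨ +-cong (sum-𝒫 (suc n) (fixFirst A w) (w · x) x E)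
                  (sum-𝒫 (suc n) (fixSuffix (ℕP.n≤1+n (suc n)) A (λ _ → v)) (w · x) x E′) ⟩
      sign ⌊ E /2⌋ * (sign (suc n C 2) * D (cons w G)) + sign ⌊ E′ /2⌋ * (sign (suc n C 2) * D (snoc (suc n) G v))
        ≈⟨ sign-combine E (suc n) _ _ ⟩
      sign ⌊ E /2⌋ * (sign (suc (suc n) C 2) * (sign (suc n) * D (cons w G) + D (snoc (suc n) G v)))
        ≈⟨ *-cong refl (*-cong refl (balancedColumns-split n A w x)) ⟨
      sign ⌊ E /2⌋ * (sign (suc (suc n) C 2) * D (balancedColumns (suc (suc n)) w x)) ∎
      where
      G = balancedColumns (suc n) (w · x) x
      cols : List ℕ → Family
      cols L = powerColumns (suc n) L (w · x) x
      v = hookColumn n w x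
      E′ = E ℕ.+ (suc n ℕ.+ suc n)
      term : List ℕ → Carrier
      term L = sign ⌊ E ℕ.+ sizeUpTo (suc (suc n)) L /2⌋ * D (powerColumns (suc (suc n)) L w x)
      short : ∀ L → StrictDec n L → term L ≈ sign ⌊ E ℕ.+ sizeUpTo (suc n) L /2⌋ * D (cons w (cols L))
      short L sL = *-cong (reflexive (P.cong (λ s → sign ⌊ E ℕ.+ s /2⌋) (sizeUpTo-beyond sL)))
                          (alt-cong A _ _ (powerColumns-short sL w x))
      hook : ∀ L → StrictDec n L →
        term (n ∷ L) ≈ sign ⌊ E′ ℕ.+ sizeUpTo (suc n) L /2⌋ * D (snoc (suc n) (cols L) v)
      hook L sL = *-cong (reflexive (P.cong (λ s → sign ⌊ s /2⌋)
                           (P.trans (P.cong (E ℕ.+_) (sizeUpTo-cons sL)) (P.sym (ℕP.+-assoc E _ _)))))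
                         (alt-cong A _ _ (powerColumns-cons sL w x))

    Wcolumns : ℕ → Column → Column → Family
    Wcolumns p w x k i = w i * (pow (x i) (p ∸ 1 ∸ k) * pow (1# + x i * x i) k)

    balanced≈W : ∀ p {D} → IsAlternating p D → (w : Column) {x x⁻¹ : Column} → (∀ i → x i * x⁻¹ i ≈ 1#) →
      D (balancedColumns p w x) ≈ D (Wcolumns p w x)
    balanced≈W p {D} A w {x} {x⁻¹} inverse = begin
      D (balancedColumns p w x)                    ≈⟨ alt-cong A _ _ balanced≋T ⟩
      D T                                          ≈⟨ powers-alternating A ⟨
      D (λ k i → pow (y i) k * T 0 i)              ≈⟨ alt-cong A _ _ powers≋W ⟩
      D (Wcolumns p w x)                           ∎
      where
      open Chebyshev inverse (λ i → w i * pow (x i) (p ∸ 1))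
      balanced≋T : balancedColumns p w x ≋[ p ] T
      balanced≋T zero    _   i = sym (*-identityʳ _)
      balanced≋T (suc k) k<p i = P.subst
        (λ e → w i * (pow (x i) m + pow (x i) (suc k) * pow (x i) e) ≈ (w i * pow (x i) e) * laurent (suc k) i)
        (ℕP.m+[n∸m]≡n (ℕP.∸-monoˡ-≤ 1 k<p)) (begin
          w i * (pow (x i) m + pow (x i) (suc k) * X)
            ≈⟨ *-cong refl (+-cong (sym (Inverses.pow-cancel (inverse i) (suc k) m)) (*-comm _ _)) ⟩
          w i * (X * pow (x⁻¹ i) (suc k) + X * pow (x i) (suc k))
            ≈⟨ solve 4 (λ w X a b → w :* (X :* b :+ X :* a) := (w :* X) :* (a :+ b))
                 refl (w i) X (pow (x i) (suc k)) (pow (x⁻¹ i) (suc k)) ⟩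
          (w i * X) * laurent (suc k) i ∎)
        where
        m = p ∸ 1 ∸ suc k
        X = pow (x i) (suc k ℕ.+ m)
      powers≋W : (λ k i → pow (y i) k * T 0 i) ≋[ p ] Wcolumns p w x
      powers≋W k k<p i = begin
        pow (y i) k * ((w i * pow (x i) (p ∸ 1)) * 1#)
          ≈⟨ solve 3 (λ Y w X → Y :* ((w :* X) :* con 1) := w :* (X :* Y)) refl (pow (y i) k) (w i) (pow (x i) (p ∸ 1)) ⟩
        w i * (pow (x i) (p ∸ 1) * pow (y i) k)
          ≈⟨ *-cong refl (Inverses.pow-∸-inverse (inverse i) (p ∸ 1) k (ℕP.∸-monoˡ-≤ 1 k<p)) ⟨
        w i * (pow (x i) (p ∸ 1 ∸ k) * pow (1# + x i * x i) k) ∎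

    det-isAlternating : IsAlternating N (λ f → det N (λ r c → f (toℕ c) r))
    det-isAlternating = record
      { alt-cong     = λ f g f≋g → det-cong N (λ r c → f≋g (toℕ c) (FinP.toℕ<n c) r)
      ; alt-linear   = λ f g h t t<N u v ft g-off h-off →
          det-linear N _ _ _ (Fin.fromℕ< t<N) u v (column f g h t<N ft) (off f g t<N g-off) (off f h t<N h-off)
      ; alt-adjacent = λ f t 1+t<N ft≋ft+1 →
          det-adjacent N _ (Fin.fromℕ< (ℕP.<-trans (ℕP.n<1+n t) 1+t<N)) (Fin.fromℕ< 1+t<N)
            (P.trans (FinP.toℕ-fromℕ< 1+t<N) (P.cong suc (P.sym (FinP.toℕ-fromℕ< _))))
            (adjacent f 1+t<N ft≋ft+1)
      }
      where
      column : ∀ (f g h : Family) {t u v} (t<N : t ℕ.< N) → f t ≋ (λ i → u * g t i + v * h t i) →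
        ∀ r → f (toℕ (Fin.fromℕ< t<N)) r ≈ u * g (toℕ (Fin.fromℕ< t<N)) r + v * h (toℕ (Fin.fromℕ< t<N)) r
      column f g h t<N ft rewrite FinP.toℕ-fromℕ< t<N = ft
      off : ∀ (f g : Family) {t} (t<N : t ℕ.< N) → (∀ k → k ≢ t → f k ≋ g k) →
        ∀ r c → c ≢ Fin.fromℕ< t<N → f (toℕ c) r ≈ g (toℕ c) r
      off f g t<N f≋g r c c≢t =
        f≋g (toℕ c) (λ eq → c≢t (FinP.toℕ-injective (P.trans eq (P.sym (FinP.toℕ-fromℕ< t<N))))) r
      adjacent : ∀ (f : Family) {t} (1+t<N : suc t ℕ.< N) → f t ≋ f (suc t) →
        ∀ r → f (toℕ (Fin.fromℕ< (ℕP.<-trans (ℕP.n<1+n t) 1+t<N))) r ≈ f (toℕ (Fin.fromℕ< 1+t<N)) r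
      adjacent f 1+t<N ft≋ft+1
        rewrite FinP.toℕ-fromℕ< (ℕP.<-trans (ℕP.n<1+n _) 1+t<N) | FinP.toℕ-fromℕ< 1+t<N = ft≋ft+1

    prepend-splitAt : ∀ p {q} (f g : Family) (c : Fin (p ℕ.+ q)) →
      prepend p f g (toℕ c) ≡ [ (λ k → f (toℕ k)) , (λ l → g (toℕ l)) ]′ (splitAt p c)
    prepend-splitAt zero    f g c       = P.refl
    prepend-splitAt (suc p) f g zero    = P.refl
    prepend-splitAt (suc p) f g (suc c) = P.trans (prepend-splitAt p (f ∘ suc) g c) (P.sym ([,]-map (splitAt p c)))

  module Identities (p q : ℕ) (x x⁻¹ a : Fin (p ℕ.+ q) → Carrier) (inverse : ∀ i → x i * x⁻¹ i ≈ 1#) where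
    open Alternating (p ℕ.+ q)

    D : Family → Carrier
    D f = det (p ℕ.+ q) (λ r c → f (toℕ c) r)

    one : Column
    one _ = 1#

    Vλμ≈blocks : ∀ L M r c → Vλμ p q L M x a r c ≈ prepend p (powerColumns p L one x) (powerColumns q M a x) (toℕ c) r
    Vλμ≈blocks L M r c rewrite prepend-splitAt p (powerColumns p L one x) (powerColumns q M a x) c with splitAt p c
    ... | inj₁ k = sym (*-identityˡ _)
    ... | inj₂ l = refl

    W≈blocks : ∀ r c → W p q x a r c ≈ prepend p (Wcolumns p one x) (Wcolumns q a x) (toℕ c) r
    W≈blocks r c rewrite prepend-splitAt p (Wcolumns p one x) (Wcolumns q a x) c with splitAt p c
    ... | inj₁ k = sym (*-identityˡ _)
    ... | inj₂ l = refl

    F≈W : F p q x a ≈ sign ((p C 2) ℕ.+ (q C 2)) * det (p ℕ.+ q) (W p q x a)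
    F≈W = begin
      F p q x a
        ≈⟨ sumList-cong (𝒫 p) (λ L → trans (sumList-cong (𝒫 q) (λ M → *-cong refl (det-cong _ (Vλμ≈blocks L M))))
                                           (sum-𝒫 q (fixPrefix p det-isAlternating (Λ L)) a x (sizeUpTo p L))) ⟩
      sumList (𝒫 p) (λ L → sign ⌊ sizeUpTo p L /2⌋ * (sign (q C 2) * D (prepend p (Λ L) Gq)))
        ≈⟨ sumList-cong (𝒫 p) (λ L → solve 3 (λ s c d → s :* (c :* d) := c :* (s :* d)) refl _ _ _) ⟩
      sumList (𝒫 p) (λ L → sign (q C 2) * (sign ⌊ 0 ℕ.+ sizeUpTo p L /2⌋ * D (prepend p (Λ L) Gq)))
        ≈⟨ sumList-*ˡ (𝒫 p) _ _ ⟩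
      sign (q C 2) * sumList (𝒫 p) (λ L → sign ⌊ 0 ℕ.+ sizeUpTo p L /2⌋ * D (prepend p (Λ L) Gq))
        ≈⟨ *-cong refl (sum-𝒫 p (fixSuffix (ℕP.m≤m+n p q) det-isAlternating Gq) one x 0) ⟩
      sign (q C 2) * (1# * (sign (p C 2) * D (prepend p Gp Gq)))
        ≈⟨ *-cong refl (*-cong refl (*-cong refl (trans
             (balanced≈W p (fixSuffix (ℕP.m≤m+n p q) det-isAlternating Gq) one inverse)
             (balanced≈W q (fixPrefix p det-isAlternating (Wcolumns p one x)) a inverse)))) ⟩
      sign (q C 2) * (1# * (sign (p C 2) * D (prepend p (Wcolumns p one x) (Wcolumns q a x))))
        ≈⟨ solve 3 (λ c b d → c :* (con 1 :* (b :* d)) := (b :* c) :* d) refl _ _ _ ⟩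
      (sign (p C 2) * sign (q C 2)) * D (prepend p (Wcolumns p one x) (Wcolumns q a x))
        ≈⟨ *-cong (sym (sign-+ (p C 2) (q C 2))) (sym (det-cong _ W≈blocks)) ⟩
      sign ((p C 2) ℕ.+ (q C 2)) * det (p ℕ.+ q) (W p q x a) ∎
      where
      Λ : List ℕ → Family
      Λ L = powerColumns p L one x
      Gp Gq : Family
      Gp = balancedColumns p one x
      Gq = balancedColumns q a x

    W≈scaledV : ∀ r c → W p q x a r c ≈ zpow (x r) (x⁻¹ r) (+ p ℤ.- + 1)
      * V p q (λ i → x i + x⁻¹ i) (λ i → a i * zpow (x i) (x⁻¹ i) (+ q ℤ.- + p)) r c
    W≈scaledV r c with splitAt p c
    ... | inj₁ k rewrite frobPart-[] (p ∸ toℕ k) = Inverses.W-entry₁ (inverse r) p (toℕ k) (FinP.toℕ<n k)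
    ... | inj₂ l rewrite frobPart-[] (q ∸ toℕ l) = Inverses.W-entry₂ (inverse r) p q (toℕ l) (a r) (FinP.toℕ<n l)

    F≈V : F p q x a ≈ sign ((p C 2) ℕ.+ (q C 2))
      * (prodFin (p ℕ.+ q) (λ i → zpow (x i) (x⁻¹ i) (+ p ℤ.- + 1))
         * det (p ℕ.+ q) (V p q (λ i → x i + x⁻¹ i) (λ i → a i * zpow (x i) (x⁻¹ i) (+ q ℤ.- + p))))
    F≈V = trans F≈W (*-cong refl (trans (det-cong _ W≈scaledV) (det-scaleRows (p ℕ.+ q) _ _)))

mainTheorem2 : {c ℓ : Level} (R : CommutativeRing c ℓ) →
    let open CommutativeRing R
        open WithRing R
    in (p q : ℕ) (x xinv a : Fin (p ℕ.+ q) → Carrier) →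
       (∀ i → x i * xinv i ≈ 1#) →
       (F p q x a
          ≈ pow (- 1#) ((p C 2) ℕ.+ (q C 2))
            * (prodFin (p ℕ.+ q) (λ i → zpow (x i) (xinv i) ((+ p) ℤ.- (+ 1)))
               * det (p ℕ.+ q) (V p q (λ i → x i + xinv i)
                                      (λ i → a i * zpow (x i) (xinv i) ((+ q) ℤ.- (+ p))))))
       × (F p q x a ≈ pow (- 1#) ((p C 2) ℕ.+ (q C 2)) * det (p ℕ.+ q) (W p q x a))
mainTheorem2 R p q x xinv a inverse = F≈V , F≈W
  where open Identities R p q x xinv a inverse
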